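{- Let $k$ be an algebraically closed field of characteristic zero, let $n$ be a positive integer, and define the algebraic group $$G_n=\{(a,g)\in GL_1\times GL_2 : a^n=\det g\}.$$ Then $G_n\cong GL_1\times SL_2$ if $n$ is even, and $G_n\cong GL_2$ if $n$ is odd. -}

module Defs where

open import Level using (Level; _⊔_; suc)
open import Data.Nat as ℕ using (ℕ; zero)
open import Data.Fin using (Fin; zero; suc; #_)
open import Data.Fin.Patterns using (0F; 1F; 2F; 3F; 4F; 5F; 6F)
open import Data.Vec using (lookup; _∷_; [])
open import Data.List using (List) renaming ([] to nil; _∷_ to cons)
open import Data.Product using (Σ; ∃; _×_; _,_)
open import Relation.Nullary using (¬_)
open import Relation.Binary.PropositionalEquality using (_≡_)
open import Algebra.Bundles using (CommutativeRing)

record Field (c ℓ : Level) : Set (Level.suc (c ⊔ ℓ)) where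
  field
    commRing : CommutativeRing c ℓ
  open CommutativeRing commRing public
  field
    0≉1     : ¬ (0# ≈ 1#)
    inverse : ∀ x → ¬ (x ≈ 0#) → Σ Carrier λ y → x * y ≈ 1#

module FieldNotions {c ℓ} (F : Field c ℓ) where
  open Field F

  pow : Carrier → ℕ → Carrier
  pow x zero      = 1#
  pow x (ℕ.suc n) = x * pow x n

  natK : ℕ → Carrier
  natK zero      = 0#
  natK (ℕ.suc n) = 1# + natK n

  -- value at x of the polynomial  c₀ + c₁ x + … + c_{d-1} x^{d-1} + x^d,
  -- where cs = c₀ ∷ … ∷ c_{d-1}  (monic of degree d = length cs)
  monicEval : List Carrier → Carrier → Carrier
  monicEval nil      x = 1#
  monicEval (cons c cs) x = c + x * monicEval cs x

  determinant : Carrier → Carrier → Carrier → Carrier → Carrier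
  determinant a b c d = a * d - b * c

-- every monic polynomial of degree ≥ 1 has a root
AlgebraicallyClosed : ∀ {c ℓ} → Field c ℓ → Set (c ⊔ ℓ)
AlgebraicallyClosed F = ∀ (c₀ : Carrier) (cs : List Carrier) →
    ∃ λ x → monicEval (cons c₀ cs) x ≈ 0#
  where open Field F; open FieldNotions F

CharacteristicZero : ∀ {c ℓ} → Field c ℓ → Set ℓ
CharacteristicZero F = ∀ n → ¬ (natK (ℕ.suc n) ≈ 0#)
  where open Field F; open FieldNotions F

data Poly {c} (K : Set c) (m : ℕ) : Set c where
  var  : Fin m → Poly K m
  con  : K → Poly K m
  _⊕_  : Poly K m → Poly K m → Poly K m
  _⊗_  : Poly K m → Poly K m → Poly K m
  ⊖_   : Poly K m → Poly K m

module _ {c ℓ} (F : Field c ℓ) where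
  open Field F

  evalPoly : ∀ {m} → Poly Carrier m → (Fin m → Carrier) → Carrier
  evalPoly (var i) v = v i
  evalPoly (con a) v = a
  evalPoly (p ⊕ q) v = evalPoly p v + evalPoly q v
  evalPoly (p ⊗ q) v = evalPoly p v * evalPoly q v
  evalPoly (⊖ p)   v = - evalPoly p v

-- A group is a closed subvariety of affine dim-space (the membership
-- predicate Mem; coordinates for inverted functions such as a⁻¹ and
-- (det g)⁻¹ are included as extra coordinates), with its multiplication
-- given on coordinates.  Regular functions are polynomials in the
-- coordinates.

Point : ∀ {c} → Set c → ℕ → Set c
Point K m = Fin m → K

record CoordGroup {c ℓ} (F : Field c ℓ) : Set (c ⊔ Level.suc ℓ) where
  open Field F using (Carrier)
  field
    dim : ℕ
    Mem : Point Carrier dim → Set ℓ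
    mul : Point Carrier dim → Point Carrier dim → Point Carrier dim

module _ {c ℓ} {F : Field c ℓ} where
  open Field F using (Carrier; _≈_)
  open CoordGroup

  _≋_ : ∀ {m} → Point Carrier m → Point Carrier m → Set ℓ
  x ≋ y = ∀ i → x i ≈ y i

  record Morphism (G H : CoordGroup F) : Set (c ⊔ ℓ) where
    field
      poly : Fin (dim H) → Poly Carrier (dim G)
    fun : Point Carrier (dim G) → Point Carrier (dim H)
    fun x j = evalPoly F (poly j) x
    field
      maps-into : ∀ x → Mem G x → Mem H (fun x)
      hom       : ∀ x y → Mem G x → Mem G y →
                    fun (mul G x y) ≋ mul H (fun x) (fun y)

  record _≅_ (G H : CoordGroup F) : Set (c ⊔ ℓ) where
    field
      to      : Morphism G H
      from    : Morphism H G
      from∘to : ∀ x → Mem G x → Morphism.fun from (Morphism.fun to x) ≋ x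
      to∘from : ∀ y → Mem H y → Morphism.fun to (Morphism.fun from y) ≋ y

module Groups {c ℓ} (F : Field c ℓ) where
  open Field F
  open FieldNotions F

  private
    P : ℕ → Set c
    P = Point Carrier

    pt5 : Carrier → Carrier → Carrier → Carrier → Carrier → P 5
    pt5 x0 x1 x2 x3 x4 = lookup (x0 ∷ x1 ∷ x2 ∷ x3 ∷ x4 ∷ [])

    pt6 : Carrier → Carrier → Carrier → Carrier → Carrier → Carrier → P 6
    pt6 x0 x1 x2 x3 x4 x5 = lookup (x0 ∷ x1 ∷ x2 ∷ x3 ∷ x4 ∷ x5 ∷ [])

    pt7 : Carrier → Carrier → Carrier → Carrier → Carrier → Carrier → Carrier → P 7
    pt7 x0 x1 x2 x3 x4 x5 x6 = lookup (x0 ∷ x1 ∷ x2 ∷ x3 ∷ x4 ∷ x5 ∷ x6 ∷ [])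

    m11 m12 m21 m22 : Carrier → Carrier → Carrier → Carrier →
                      Carrier → Carrier → Carrier → Carrier → Carrier
    m11 p11 p12 p21 p22 q11 q12 q21 q22 = p11 * q11 + p12 * q21
    m12 p11 p12 p21 p22 q11 q12 q21 q22 = p11 * q12 + p12 * q22
    m21 p11 p12 p21 p22 q11 q12 q21 q22 = p21 * q11 + p22 * q21
    m22 p11 p12 p21 p22 q11 q12 q21 q22 = p21 * q12 + p22 * q22

  -- G_n = {(a,g) ∈ GL₁ × GL₂ : aⁿ = det g}.
  -- Coordinates (0..6): a, a⁻¹, g₁₁, g₁₂, g₂₁, g₂₂, (det g)⁻¹.
  G : ℕ → CoordGroup F
  G n = record
    { dim = 7
    ; Mem = λ x →
        (x 0F * x 1F ≈ 1#)
        × (determinant (x 2F) (x 3F) (x 4F) (x 5F) * x 6F ≈ 1#)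
        × (pow (x 0F) n ≈ determinant (x 2F) (x 3F) (x 4F) (x 5F))
    ; mul = λ x y → pt7
        (x 0F * y 0F) (x 1F * y 1F)
        (m11 (x 2F) (x 3F) (x 4F) (x 5F) (y 2F) (y 3F) (y 4F) (y 5F))
        (m12 (x 2F) (x 3F) (x 4F) (x 5F) (y 2F) (y 3F) (y 4F) (y 5F))
        (m21 (x 2F) (x 3F) (x 4F) (x 5F) (y 2F) (y 3F) (y 4F) (y 5F))
        (m22 (x 2F) (x 3F) (x 4F) (x 5F) (y 2F) (y 3F) (y 4F) (y 5F))
        (x 6F * y 6F)
    }

  -- GL₁ × SL₂.  Coordinates (0..5): b, b⁻¹, h₁₁, h₁₂, h₂₁, h₂₂.
  GL1×SL2 : CoordGroup F
  GL1×SL2 = record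
    { dim = 6
    ; Mem = λ x →
        (x 0F * x 1F ≈ 1#)
        × (determinant (x 2F) (x 3F) (x 4F) (x 5F) ≈ 1#)
    ; mul = λ x y → pt6
        (x 0F * y 0F) (x 1F * y 1F)
        (m11 (x 2F) (x 3F) (x 4F) (x 5F) (y 2F) (y 3F) (y 4F) (y 5F))
        (m12 (x 2F) (x 3F) (x 4F) (x 5F) (y 2F) (y 3F) (y 4F) (y 5F))
        (m21 (x 2F) (x 3F) (x 4F) (x 5F) (y 2F) (y 3F) (y 4F) (y 5F))
        (m22 (x 2F) (x 3F) (x 4F) (x 5F) (y 2F) (y 3F) (y 4F) (y 5F))
    }

  -- GL₂.  Coordinates (0..4): h₁₁, h₁₂, h₂₁, h₂₂, (det h)⁻¹.
  GL2 : CoordGroup F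
  GL2 = record
    { dim = 5
    ; Mem = λ x → determinant (x 0F) (x 1F) (x 2F) (x 3F) * x 4F ≈ 1#
    ; mul = λ x y → pt5
        (m11 (x 0F) (x 1F) (x 2F) (x 3F) (y 0F) (y 1F) (y 2F) (y 3F))
        (m12 (x 0F) (x 1F) (x 2F) (x 3F) (y 0F) (y 1F) (y 2F) (y 3F))
        (m21 (x 0F) (x 1F) (x 2F) (x 3F) (y 0F) (y 1F) (y 2F) (y 3F))
        (m22 (x 0F) (x 1F) (x 2F) (x 3F) (y 0F) (y 1F) (y 2F) (y 3F))
        (x 4F * y 4F)
    }

Even : ℕ → Set
Even n = ∃ λ k → n ≡ k ℕ.+ k

Odd : ℕ → Set
Odd n = ∃ λ k → n ≡ ℕ.suc (k ℕ.+ k)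

module Submission where

-- Over any field k, G_n = {(a, g) ∈ GL₁ × GL₂ : aⁿ = det g} is isomorphic to
-- GL₁ × SL₂ for n = 2k even and to GL₂ for n = 2k + 1 odd; the proof is a
-- twist of the matrix coordinate by a power of a character.
--
--   n = 2k :     (a, g) ↦ (a, a⁻ᵏ g),          inverse (b, h) ↦ (b, bᵏ h);
--   n = 2k + 1 : (a, g) ↦ a⁻ᵏ g,               inverse h ↦ (det h, (det h)ᵏ h).
--
-- Indeed det (a⁻ᵏ g) = a⁻²ᵏ aⁿ, which is 1 resp. a.

open import Defs
open import Data.Nat as ℕ using (ℕ; _≥_; zero; suc)
open import Data.Product using (_×_; _,_)
open import Data.Fin using (Fin)
open import Data.Fin.Patterns using (0F; 1F; 2F; 3F; 4F; 5F; 6F)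
open import Data.Vec using (lookup; _∷_; [])
open import Algebra.Bundles using (CommutativeRing)
open import Level using (_⊔_)
import Relation.Binary.PropositionalEquality as ≡

module RingFacts {c ℓ} (R : CommutativeRing c ℓ) where
  open CommutativeRing R
  open import Algebra.Properties.Ring ring using (-‿distribˡ-*; -‿distribʳ-*; x[y-z]≈xy-xz)
  open import Algebra.Properties.AbelianGroup +-abelianGroup using (⁻¹-∙-comm; ⁻¹-involutive)
  open import Algebra.Properties.CommutativeSemiring.Exp commutativeSemiring public
    using (_^_; ^-congˡ; ^-homo-*; ^-distrib-*)
  open import Algebra.Solver.Ring.NaturalCoefficients.Default commutativeSemiring
    using (solve; _:=_; _:+_; _:*_)
  open import Relation.Binary.Reasoning.Setoid setoid

  det : Carrier → Carrier → Carrier → Carrier → Carrier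
  det a b c d = a * d - b * c

  interchange : ∀ x y u v → (x * y) * (u * v) ≈ (x * u) * (y * v)
  interchange = solve 4 (λ x y u v → (x :* y) :* (u :* v) := (x :* u) :* (y :* v)) refl

  square-one : ∀ {u} → u ≈ 1# → u * u ≈ 1#
  square-one u≈1 = trans (*-cong u≈1 u≈1) (*-identityˡ 1#)

  cancel : ∀ {p q} z → p * q ≈ 1# → p * (q * z) ≈ z
  cancel {p} {q} z pq≈1 = begin
    p * (q * z)  ≈⟨ *-assoc p q z ⟨
    (p * q) * z  ≈⟨ *-congʳ pq≈1 ⟩
    1# * z       ≈⟨ *-identityˡ z ⟩
    z            ∎

  inverse-unique : ∀ {a b d x} → a * b ≈ 1# → a ≈ d → d * x ≈ 1# → x ≈ b
  inverse-unique {a} {b} {d} {x} ab≈1 a≈d dx≈1 = begin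
    x             ≈⟨ cancel x ba≈1 ⟨
    b * (a * x)   ≈⟨ *-congˡ (trans (*-congʳ a≈d) dx≈1) ⟩
    b * 1#        ≈⟨ *-identityʳ b ⟩
    b             ∎
    where ba≈1 = trans (*-comm b a) ab≈1

  ^-inverse : ∀ {x y} k → x * y ≈ 1# → x ^ k * y ^ k ≈ 1#
  ^-inverse zero    xy≈1 = *-identityˡ 1#
  ^-inverse {x} {y} (suc k) xy≈1 = begin
    (x * x ^ k) * (y * y ^ k)    ≈⟨ interchange x (x ^ k) y (y ^ k) ⟩
    (x * y) * (x ^ k * y ^ k)    ≈⟨ *-cong xy≈1 (^-inverse k xy≈1) ⟩
    1# * 1#                      ≈⟨ *-identityˡ 1# ⟩
    1#                           ∎

  -- An entry of the product of the matrices p·g and q·h, where s ≈ p q.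
  scaled-entry : ∀ {s p q} → s ≈ p * q → ∀ u v w z →
                 s * (u * v + w * z) ≈ (p * u) * (q * v) + (p * w) * (q * z)
  scaled-entry {s} {p} {q} s≈pq u v w z = begin
    s * (u * v + w * z)                        ≈⟨ *-congʳ s≈pq ⟩
    (p * q) * (u * v + w * z)                  ≈⟨ distribˡ (p * q) (u * v) (w * z) ⟩
    (p * q) * (u * v) + (p * q) * (w * z)      ≈⟨ +-cong (interchange p q u v) (interchange p q w z) ⟩
    (p * u) * (q * v) + (p * w) * (q * z)      ∎

  det-scale : ∀ p a b c d → det (p * a) (p * b) (p * c) (p * d) ≈ (p * p) * det a b c d
  det-scale p a b c d = begin
    (p * a) * (p * d) - (p * b) * (p * c)   ≈⟨ +-cong (interchange p a p d) (-‿cong (interchange p b p c)) ⟩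
    (p * p) * (a * d) - (p * p) * (b * c)   ≈⟨ x[y-z]≈xy-xz (p * p) (a * d) (b * c) ⟨
    (p * p) * (a * d - b * c)               ∎

  det-unscale : ∀ {p s t} a b c d → p * s ≈ 1# → det a b c d ≈ t * (s * s) →
                det (p * a) (p * b) (p * c) (p * d) ≈ t
  det-unscale {p} {s} {t} a b c d ps≈1 det≈ts² = begin
    det (p * a) (p * b) (p * c) (p * d)  ≈⟨ det-scale p a b c d ⟩
    (p * p) * det a b c d                ≈⟨ *-congˡ det≈ts² ⟩
    (p * p) * (t * (s * s))              ≈⟨ solve 3 (λ p s t → (p :* p) :* (t :* (s :* s)) := t :* ((p :* s) :* (p :* s))) refl p s t ⟩
    t * ((p * s) * (p * s))              ≈⟨ *-congˡ (square-one ps≈1) ⟩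
    t * 1#                               ≈⟨ *-identityʳ t ⟩
    t                                    ∎

  difference-cross : ∀ {x y z w} → x + w ≈ z + y → x - y ≈ z - w
  difference-cross {x} {y} {z} {w} cross = begin
    x - y                     ≈⟨ +-identityʳ (x - y) ⟨
    (x - y) + 0#              ≈⟨ +-congˡ (-‿inverseʳ w) ⟨
    (x - y) + (w - w)         ≈⟨ solve 4 (λ x y w w' → (x :+ y) :+ (w :+ w') := (x :+ w) :+ (y :+ w')) refl x (- y) w (- w) ⟩
    (x + w) + (- y - w)       ≈⟨ +-congʳ cross ⟩
    (z + y) + (- y - w)       ≈⟨ solve 4 (λ z y y' w' → (z :+ y) :+ (y' :+ w') := (z :+ w') :+ (y :+ y')) refl z y (- y) (- w) ⟩
    (z - w) + (y - y)         ≈⟨ +-congˡ (-‿inverseʳ y) ⟩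
    (z - w) + 0#              ≈⟨ +-identityʳ (z - w) ⟩
    z - w                     ∎

  product-of-differences : ∀ u v s t → (u - v) * (s - t) ≈ (u * s + v * t) - (u * t + v * s)
  product-of-differences u v s t = begin
    (u - v) * (s - t)
      ≈⟨ solve 4 (λ u v' s t' → (u :+ v') :* (s :+ t') := (u :* s :+ v' :* t') :+ (u :* t' :+ v' :* s)) refl u (- v) s (- t) ⟩
    (u * s + - v * - t) + (u * - t + - v * s)
      ≈⟨ +-cong (+-congˡ neg-neg) (+-cong (sym (-‿distribʳ-* u t)) (sym (-‿distribˡ-* v s))) ⟩
    (u * s + v * t) + (- (u * t) + - (v * s))
      ≈⟨ +-congˡ (⁻¹-∙-comm (u * t) (v * s)) ⟩
    (u * s + v * t) - (u * t + v * s)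
      ∎
    where
    neg-neg : - v * - t ≈ v * t
    neg-neg = begin
      - v * - t      ≈⟨ -‿distribˡ-* v (- t) ⟨
      - (v * - t)    ≈⟨ -‿cong (-‿distribʳ-* v t) ⟨
      - - (v * t)    ≈⟨ ⁻¹-involutive (v * t) ⟩
      v * t          ∎

  det-mul : ∀ a b c d e f g h →
            det (a * e + b * g) (a * f + b * h) (c * e + d * g) (c * f + d * h) ≈ det a b c d * det e f g h
  det-mul a b c d e f g h = begin
    det (a * e + b * g) (a * f + b * h) (c * e + d * g) (c * f + d * h)
      ≈⟨ difference-cross (solve 8 (λ a b c d e f g h →
           (a :* e :+ b :* g) :* (c :* f :+ d :* h) :+ ((a :* d) :* (f :* g) :+ (b :* c) :* (e :* h))
             := ((a :* d) :* (e :* h) :+ (b :* c) :* (f :* g)) :+ (a :* f :+ b :* h) :* (c :* e :+ d :* g))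
           refl a b c d e f g h) ⟩
    ((a * d) * (e * h) + (b * c) * (f * g)) - ((a * d) * (f * g) + (b * c) * (e * h))
      ≈⟨ product-of-differences (a * d) (b * c) (e * h) (f * g) ⟨
    det a b c d * det e f g h
      ∎

module Twisting {c ℓ} (F : Field c ℓ) where
  open Field F
  open FieldNotions F
  open Groups F
  open RingFacts commRing
  open import Relation.Binary.Reasoning.Setoid setoid

  pow≈^ : ∀ x n → pow x n ≈ x ^ n
  pow≈^ x zero    = refl
  pow≈^ x (suc n) = *-congˡ (pow≈^ x n)

  infixr 8 _^ₚ_
  _^ₚ_ : ∀ {m} → Poly Carrier m → ℕ → Poly Carrier m
  χ ^ₚ zero  = con 1#
  χ ^ₚ suc k = χ ⊗ (χ ^ₚ k)

  eval-^ₚ : ∀ {m} (χ : Poly Carrier m) k x → evalPoly F (χ ^ₚ k) x ≈ evalPoly F χ x ^ k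
  eval-^ₚ χ zero    x = refl
  eval-^ₚ χ (suc k) x = *-congˡ (eval-^ₚ χ k x)

  Character : (H : CoordGroup F) → Poly Carrier (CoordGroup.dim H) → Set (c ⊔ ℓ)
  Character H χ = ∀ x y → evalPoly F χ (CoordGroup.mul H x y) ≈ evalPoly F χ x * evalPoly F χ y

  ^ₚ-character : ∀ {H} {χ} → Character H χ → ∀ k → Character H (χ ^ₚ k)
  ^ₚ-character {H} {χ} χ-mul k x y = begin
    evalPoly F (χ ^ₚ k) (mul x y)                      ≈⟨ eval-^ₚ χ k (mul x y) ⟩
    evalPoly F χ (mul x y) ^ k                         ≈⟨ ^-congˡ k (χ-mul x y) ⟩
    (evalPoly F χ x * evalPoly F χ y) ^ k              ≈⟨ ^-distrib-* _ _ k ⟩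
    evalPoly F χ x ^ k * evalPoly F χ y ^ k            ≈⟨ *-cong (eval-^ₚ χ k x) (eval-^ₚ χ k y) ⟨
    evalPoly F (χ ^ₚ k) x * evalPoly F (χ ^ₚ k) y      ∎
    where open CoordGroup H using (mul)

  ^ₚ-inverse : ∀ {m m′} (χ : Poly Carrier m) (ψ : Poly Carrier m′) k x y →
               evalPoly F χ x * evalPoly F ψ y ≈ 1# →
               evalPoly F (χ ^ₚ k) x * evalPoly F (ψ ^ₚ k) y ≈ 1#
  ^ₚ-inverse χ ψ k x y χψ≈1 =
    trans (*-cong (eval-^ₚ χ k x) (eval-^ₚ ψ k y)) (^-inverse k χψ≈1)

  detₚ : Poly Carrier 5
  detₚ = (var 0F ⊗ var 3F) ⊕ (⊖ (var 1F ⊗ var 2F))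

  det-character : Character GL2 detₚ
  det-character x y = det-mul (x 0F) (x 1F) (x 2F) (x 3F) (y 0F) (y 1F) (y 2F) (y 3F)

  G-member : ∀ n x → x 0F * x 1F ≈ 1# → det (x 2F) (x 3F) (x 4F) (x 5F) ≈ x 0F ^ n →
             x 6F ≈ x 1F ^ n → CoordGroup.Mem (G n) x
  G-member n x aa⁻¹≈1 det≈aⁿ δ≈a⁻ⁿ =
      aa⁻¹≈1
    , trans (*-cong det≈aⁿ δ≈a⁻ⁿ) (^-inverse n aa⁻¹≈1)
    , trans (pow≈^ (x 0F) n) (sym det≈aⁿ)

  G-det : ∀ n x → CoordGroup.Mem (G n) x → det (x 2F) (x 3F) (x 4F) (x 5F) ≈ x 0F ^ n
  G-det n x (_ , _ , aⁿ≈det) = trans (sym aⁿ≈det) (pow≈^ (x 0F) n)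

  G-det-inverse : ∀ n x → CoordGroup.Mem (G n) x → x 6F ≈ x 1F ^ n
  G-det-inverse n x m@(aa⁻¹≈1 , det·δ≈1 , _) =
    inverse-unique (^-inverse n aa⁻¹≈1) (sym (G-det n x m)) det·δ≈1

  module EvenCase (k : ℕ) where
    a⁻ᵏ : Poly Carrier 7
    a⁻ᵏ = var 1F ^ₚ k

    bᵏ : Poly Carrier 6
    bᵏ = var 0F ^ₚ k

    a⁻ᵏ-character : Character (G (k ℕ.+ k)) a⁻ᵏ
    a⁻ᵏ-character = ^ₚ-character {G (k ℕ.+ k)} {var 1F} (λ _ _ → refl) k

    bᵏ-character : Character GL1×SL2 bᵏ
    bᵏ-character = ^ₚ-character {GL1×SL2} {var 0F} (λ _ _ → refl) k

    b⁻²ᵏ-character : Character GL1×SL2 (var 1F ^ₚ (k ℕ.+ k))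
    b⁻²ᵏ-character = ^ₚ-character {GL1×SL2} {var 1F} (λ _ _ → refl) (k ℕ.+ k)

    to : Morphism (G (k ℕ.+ k)) GL1×SL2
    to = record
      { poly = lookup (var 0F ∷ var 1F ∷ (a⁻ᵏ ⊗ var 2F) ∷ (a⁻ᵏ ⊗ var 3F) ∷ (a⁻ᵏ ⊗ var 4F) ∷ (a⁻ᵏ ⊗ var 5F) ∷ [])
      ; maps-into = λ x m@(aa⁻¹≈1 , _) → aa⁻¹≈1 , twisted-det x m
      ; hom = λ x y _ _ → λ
          { 0F → refl ; 1F → refl
          ; 2F → scaled-entry (a⁻ᵏ-character x y) _ _ _ _
          ; 3F → scaled-entry (a⁻ᵏ-character x y) _ _ _ _
          ; 4F → scaled-entry (a⁻ᵏ-character x y) _ _ _ _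
          ; 5F → scaled-entry (a⁻ᵏ-character x y) _ _ _ _ }
      }
      where
      -- det (a⁻ᵏ g) = a⁻²ᵏ det g = 1
      twisted-det : ∀ x → CoordGroup.Mem (G (k ℕ.+ k)) x →
                    det (evalPoly F a⁻ᵏ x * x 2F) (evalPoly F a⁻ᵏ x * x 3F)
                        (evalPoly F a⁻ᵏ x * x 4F) (evalPoly F a⁻ᵏ x * x 5F) ≈ 1#
      twisted-det x m@(aa⁻¹≈1 , _) =
        det-unscale (x 2F) (x 3F) (x 4F) (x 5F)
          (^ₚ-inverse (var 1F) (var 0F) k x x (trans (*-comm (x 1F) (x 0F)) aa⁻¹≈1))
          (begin
            det (x 2F) (x 3F) (x 4F) (x 5F)   ≈⟨ G-det (k ℕ.+ k) x m ⟩
            x 0F ^ (k ℕ.+ k)                   ≈⟨ ^-homo-* (x 0F) k k ⟩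
            x 0F ^ k * x 0F ^ k                ≈⟨ *-cong (eval-^ₚ (var 0F) k x) (eval-^ₚ (var 0F) k x) ⟨
            aᵏ * aᵏ                            ≈⟨ *-identityˡ (aᵏ * aᵏ) ⟨
            1# * (aᵏ * aᵏ)                     ∎)
        where aᵏ = evalPoly F (var 0F ^ₚ k) x

    from-coordinates : Fin 7 → Poly Carrier 6
    from-coordinates = lookup (var 0F ∷ var 1F ∷ (bᵏ ⊗ var 2F) ∷ (bᵏ ⊗ var 3F) ∷ (bᵏ ⊗ var 4F) ∷ (bᵏ ⊗ var 5F)
                               ∷ var 1F ^ₚ (k ℕ.+ k) ∷ [])

    from : Morphism GL1×SL2 (G (k ℕ.+ k))
    from = record
      { poly = from-coordinates
      ; maps-into = λ y (bb⁻¹≈1 , det≈1) →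
          G-member (k ℕ.+ k) (λ j → evalPoly F (from-coordinates j) y) bb⁻¹≈1 (scaled-det y det≈1) (eval-^ₚ (var 1F) (k ℕ.+ k) y)
      ; hom = λ x y _ _ → λ
          { 0F → refl ; 1F → refl
          ; 2F → scaled-entry (bᵏ-character x y) _ _ _ _
          ; 3F → scaled-entry (bᵏ-character x y) _ _ _ _
          ; 4F → scaled-entry (bᵏ-character x y) _ _ _ _
          ; 5F → scaled-entry (bᵏ-character x y) _ _ _ _
          ; 6F → b⁻²ᵏ-character x y }
      }
      where
      -- det (bᵏ h) = b²ᵏ det h = b²ᵏ
      scaled-det : ∀ y → det (y 2F) (y 3F) (y 4F) (y 5F) ≈ 1# →
                   det (evalPoly F bᵏ y * y 2F) (evalPoly F bᵏ y * y 3F)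
                       (evalPoly F bᵏ y * y 4F) (evalPoly F bᵏ y * y 5F) ≈ y 0F ^ (k ℕ.+ k)
      scaled-det y det≈1 = let β = evalPoly F bᵏ y in begin
        det (β * y 2F) (β * y 3F) (β * y 4F) (β * y 5F)   ≈⟨ det-scale β (y 2F) (y 3F) (y 4F) (y 5F) ⟩
        (β * β) * det (y 2F) (y 3F) (y 4F) (y 5F)         ≈⟨ *-congˡ det≈1 ⟩
        (β * β) * 1#                                      ≈⟨ *-identityʳ (β * β) ⟩
        β * β                                             ≈⟨ *-cong (eval-^ₚ (var 0F) k y) (eval-^ₚ (var 0F) k y) ⟩
        y 0F ^ k * y 0F ^ k                               ≈⟨ ^-homo-* (y 0F) k k ⟨
        y 0F ^ (k ℕ.+ k)                                  ∎

    iso : G (k ℕ.+ k) ≅ GL1×SL2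
    iso = record
      { to = to ; from = from
      ; from∘to = λ x m@(aa⁻¹≈1 , _) →
          let aᵏa⁻ᵏ≈1 = ^ₚ-inverse (var 0F) (var 1F) k (Morphism.fun to x) x aa⁻¹≈1 in λ
          { 0F → refl ; 1F → refl
          ; 2F → cancel _ aᵏa⁻ᵏ≈1 ; 3F → cancel _ aᵏa⁻ᵏ≈1
          ; 4F → cancel _ aᵏa⁻ᵏ≈1 ; 5F → cancel _ aᵏa⁻ᵏ≈1
          ; 6F → trans (eval-^ₚ (var 1F) (k ℕ.+ k) _) (sym (G-det-inverse (k ℕ.+ k) x m)) }
      ; to∘from = λ y (bb⁻¹≈1 , _) →
          let b⁻ᵏbᵏ≈1 = ^ₚ-inverse (var 1F) (var 0F) k (Morphism.fun from y) y
                                   (trans (*-comm (y 1F) (y 0F)) bb⁻¹≈1) in λ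
          { 0F → refl ; 1F → refl
          ; 2F → cancel _ b⁻ᵏbᵏ≈1 ; 3F → cancel _ b⁻ᵏbᵏ≈1
          ; 4F → cancel _ b⁻ᵏbᵏ≈1 ; 5F → cancel _ b⁻ᵏbᵏ≈1 }
      }

  module OddCase (k : ℕ) where
    n : ℕ
    n = suc (k ℕ.+ k)

    a⁻ᵏ : Poly Carrier 7
    a⁻ᵏ = var 1F ^ₚ k

    Dᵏ : Poly Carrier 5
    Dᵏ = detₚ ^ₚ k

    a⁻ᵏ-character : Character (G n) a⁻ᵏ
    a⁻ᵏ-character = ^ₚ-character {G n} {var 1F} (λ _ _ → refl) k

    Dᵏ-character : Character GL2 Dᵏ
    Dᵏ-character = ^ₚ-character {GL2} {detₚ} det-character k

    δⁿ-character : Character GL2 (var 4F ^ₚ n)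
    δⁿ-character = ^ₚ-character {GL2} {var 4F} (λ _ _ → refl) n

    -- det (a⁻ᵏ g) = a⁻²ᵏ a²ᵏ⁺¹ = a
    twisted-det : ∀ x → CoordGroup.Mem (G n) x →
                  det (evalPoly F a⁻ᵏ x * x 2F) (evalPoly F a⁻ᵏ x * x 3F)
                      (evalPoly F a⁻ᵏ x * x 4F) (evalPoly F a⁻ᵏ x * x 5F) ≈ x 0F
    twisted-det x m@(aa⁻¹≈1 , _) =
      det-unscale (x 2F) (x 3F) (x 4F) (x 5F)
        (^ₚ-inverse (var 1F) (var 0F) k x x (trans (*-comm (x 1F) (x 0F)) aa⁻¹≈1))
        (begin
          det (x 2F) (x 3F) (x 4F) (x 5F)   ≈⟨ G-det n x m ⟩
          x 0F * x 0F ^ (k ℕ.+ k)            ≈⟨ *-congˡ (^-homo-* (x 0F) k k) ⟩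
          x 0F * (x 0F ^ k * x 0F ^ k)       ≈⟨ *-congˡ (*-cong (eval-^ₚ (var 0F) k x) (eval-^ₚ (var 0F) k x)) ⟨
          x 0F * (aᵏ * aᵏ)                   ∎)
      where aᵏ = evalPoly F (var 0F ^ₚ k) x

    to-coordinates : Fin 5 → Poly Carrier 7
    to-coordinates = lookup ((a⁻ᵏ ⊗ var 2F) ∷ (a⁻ᵏ ⊗ var 3F) ∷ (a⁻ᵏ ⊗ var 4F) ∷ (a⁻ᵏ ⊗ var 5F) ∷ var 1F ∷ [])

    to : Morphism (G n) GL2
    to = record
      { poly = to-coordinates
      ; maps-into = λ x m@(aa⁻¹≈1 , _) → trans (*-congʳ (twisted-det x m)) aa⁻¹≈1
      ; hom = λ x y _ _ → λ
          { 0F → scaled-entry (a⁻ᵏ-character x y) _ _ _ _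
          ; 1F → scaled-entry (a⁻ᵏ-character x y) _ _ _ _
          ; 2F → scaled-entry (a⁻ᵏ-character x y) _ _ _ _
          ; 3F → scaled-entry (a⁻ᵏ-character x y) _ _ _ _
          ; 4F → refl }
      }

    from-coordinates : Fin 7 → Poly Carrier 5
    from-coordinates = lookup (detₚ ∷ var 4F ∷ (Dᵏ ⊗ var 0F) ∷ (Dᵏ ⊗ var 1F) ∷ (Dᵏ ⊗ var 2F) ∷ (Dᵏ ⊗ var 3F)
                               ∷ var 4F ^ₚ n ∷ [])

    from : Morphism GL2 (G n)
    from = record
      { poly = from-coordinates
      ; maps-into = λ y Dδ≈1 →
          G-member n (λ j → evalPoly F (from-coordinates j) y) Dδ≈1 (scaled-det y) (eval-^ₚ (var 4F) n y)
      ; hom = λ x y _ _ → λ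
          { 0F → det-character x y
          ; 1F → refl
          ; 2F → scaled-entry (Dᵏ-character x y) _ _ _ _
          ; 3F → scaled-entry (Dᵏ-character x y) _ _ _ _
          ; 4F → scaled-entry (Dᵏ-character x y) _ _ _ _
          ; 5F → scaled-entry (Dᵏ-character x y) _ _ _ _
          ; 6F → δⁿ-character x y }
      }
      where
      -- det (Dᵏ h) = D²ᵏ D = Dⁿ  for D = det h
      scaled-det : ∀ y → let D = evalPoly F detₚ y ; β = evalPoly F Dᵏ y in
                   det (β * y 0F) (β * y 1F) (β * y 2F) (β * y 3F) ≈ D ^ n
      scaled-det y = let D = evalPoly F detₚ y ; β = evalPoly F Dᵏ y in begin
        det (β * y 0F) (β * y 1F) (β * y 2F) (β * y 3F)   ≈⟨ det-scale β (y 0F) (y 1F) (y 2F) (y 3F) ⟩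
        (β * β) * D                                       ≈⟨ *-comm (β * β) D ⟩
        D * (β * β)                                       ≈⟨ *-congˡ (*-cong (eval-^ₚ detₚ k y) (eval-^ₚ detₚ k y)) ⟩
        D * (D ^ k * D ^ k)                               ≈⟨ *-congˡ (^-homo-* D k k) ⟨
        D ^ n                                             ∎

    iso : G n ≅ GL2
    iso = record
      { to = to ; from = from
      ; from∘to = λ x m@(aa⁻¹≈1 , _) →
          let t = Morphism.fun to x
              Dᵏa⁻ᵏ≈1 = ^ₚ-inverse detₚ (var 1F) k t x (trans (*-congʳ (twisted-det x m)) aa⁻¹≈1) in λ
          { 0F → twisted-det x m
          ; 1F → refl
          ; 2F → cancel _ Dᵏa⁻ᵏ≈1 ; 3F → cancel _ Dᵏa⁻ᵏ≈1
          ; 4F → cancel _ Dᵏa⁻ᵏ≈1 ; 5F → cancel _ Dᵏa⁻ᵏ≈1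
          ; 6F → trans (eval-^ₚ (var 4F) n t) (sym (G-det-inverse n x m)) }
      ; to∘from = λ y Dδ≈1 →
          let δᵏDᵏ≈1 = ^ₚ-inverse (var 1F) detₚ k (Morphism.fun from y) y
                                  (trans (*-comm (y 4F) (evalPoly F detₚ y)) Dδ≈1) in λ
          { 0F → cancel _ δᵏDᵏ≈1 ; 1F → cancel _ δᵏDᵏ≈1
          ; 2F → cancel _ δᵏDᵏ≈1 ; 3F → cancel _ δᵏDᵏ≈1
          ; 4F → refl }
      }

-- Lemma 9.3.21.
lemma9p3p21 : ∀ {c ℓ} (F : Field c ℓ) → AlgebraicallyClosed F → CharacteristicZero F → (n : ℕ) → n ≥ 1 → (Even n → Groups.G F n ≅ Groups.GL1×SL2 F) × (Odd n → Groups.G F n ≅ Groups.GL2 F)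
lemma9p3p21 F _ _ n _ =
    (λ { (k , ≡.refl) → Twisting.EvenCase.iso F k })
  , (λ { (k , ≡.refl) → Twisting.OddCase.iso F k })
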